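{- For every nonnegative integer $n$, \[ \sum_{k=0}^n \frac{(q^{ -n})_k (c)_{2k}}{(q,aq,c/a)_k}\, q^k =\frac{(c)_n}{(aq^{1-n}/c)_n}\, \sum_{k=0}^n \frac{(q^{ -n})_k(aq^{1-n}/c)_{2k}} {(q,aq,q^{1-n}/c)_k}\, q^k, \] as an identity of rational functions in the indeterminates $a,c,q$.
   Context: For a nonnegative integer $k$, $(x)_k=(x;q)_k:=\prod_{i=0}^{k-1}(1-xq^i)$, and $(x_1,\dots,x_j)_k:=(x_1)_k\cdots(x_j)_k$. -}

module Defs where

open import Data.Nat using (ℕ; zero; suc)
open import Data.Rational using (ℚ; 0ℚ; 1ℚ; _+_; _*_; _-_; _÷_; ≢-nonZero)
open import Data.Rational.Properties using (_≟_)
open import Relation.Nullary using (yes; no)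

-- Total division on ℚ: p ⊘ r = p / r when r ≠ 0 (and 0 when r = 0;
-- the statement only uses it where r ≠ 0 is assumed).
infixl 7 _⊘_
_⊘_ : ℚ → ℚ → ℚ
p ⊘ r with r ≟ 0ℚ
... | yes _ = 0ℚ
... | no r≢0 = _÷_ p r {{≢-nonZero r≢0}}

infixr 8 _^_
_^_ : ℚ → ℕ → ℚ
x ^ zero = 1ℚ
x ^ suc n = x * (x ^ n)

poch : ℚ → ℚ → ℕ → ℚ
poch x q zero = 1ℚ
poch x q (suc k) = poch x q k * (1ℚ - x * q ^ k)

sumTo : ℕ → (ℕ → ℚ) → ℚ
sumTo zero f = f zero
sumTo (suc n) f = sumTo n f + f (suc n)

{-# OPTIONS --safe #-}
module Submission where

-- Multiplying the left-hand sum by (aq; q)_n aⁿ (c/a; q)_n gives a polynomial Φ n a c, once the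
-- weights (q⁻ⁿ; q)_k qᵏ / (q; q)_k are read as the coefficients of ∏_{i<n} (1 - z q⁻ⁱ). The Pascal
-- recursion of these coefficients yields two contiguous relations expressing Φ (n+1) through Φ n at
-- shifted arguments, and from them induction on n gives the symmetry
-- c²ⁿ q^(n(n-1)) Φ n a d = aⁿ Φ n a c whenever c d qⁿ = a q.
-- With d = a q^(1-n)/c and e = q^(1-n)/c, the right-hand side is (c; q)_n / (d; q)_n times Φ n a d
-- over (aq; q)_n aⁿ (e; q)_n. Reading (d; q)_n and (e; q)_n backwards turns
-- (c; q)_n / ((d; q)_n (e; q)_n) into c²ⁿ q^(n(n-1)) / (aⁿ (c/a; q)_n), and the symmetry finishes.

open import Defs
open import Data.Nat using (ℕ; zero; suc; _+_; _∸_; _≤_; _<_; z≤n; s≤s)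
import Data.Nat.Properties as ℕ
open import Data.Rational using (ℚ; 0ℚ; 1ℚ; _*_; _-_; -_; 1/_; ≢-nonZero)
import Data.Rational as ℚ
open import Data.Rational.Properties
  using ( +-*-commutativeRing; +-0-group; _≟_; 1≢0; +-assoc; *-assoc; *-comm; *-distribˡ-+
        ; *-inverseˡ; *-identityˡ; *-identityʳ; *-zeroˡ; *-zeroʳ)
open import Algebra.Properties.Group +-0-group using (x∙y⁻¹≈ε⇒x≈y)
open import Data.Empty using (⊥-elim)
open import Level using (0ℓ)
open import Relation.Nullary using (yes; no)
open import Relation.Nullary.Decidable using (dec⇒maybe)
open import Relation.Binary.PropositionalEquality
open import Tactic.RingSolver using (solve-∀)
open import Tactic.RingSolver.Core.AlmostCommutativeRing using (AlmostCommutativeRing; fromCommutativeRing)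

open ≡-Reasoning

ℚ-ring : AlmostCommutativeRing 0ℓ 0ℓ
ℚ-ring = fromCommutativeRing +-*-commutativeRing (λ x → dec⇒maybe (0ℚ ≟ x))

*-cancelˡ-≡ : ∀ {z x y} → z ≢ 0ℚ → z * x ≡ z * y → x ≡ y
*-cancelˡ-≡ {z} {x} {y} z≢0 zx≡zy = begin
  x              ≡⟨ 1/z*[z*w]≡w x ⟨
  1/ z * (z * x) ≡⟨ cong (1/ z *_) zx≡zy ⟩
  1/ z * (z * y) ≡⟨ 1/z*[z*w]≡w y ⟩
  y              ∎
  where
  instance _ = ≢-nonZero z≢0
  1/z*[z*w]≡w : ∀ w → 1/ z * (z * w) ≡ w
  1/z*[z*w]≡w w = trans (sym (*-assoc (1/ z) z w)) (trans (cong (_* w) (*-inverseˡ z)) (*-identityˡ w))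

x*y≢0 : ∀ {x y} → x ≢ 0ℚ → y ≢ 0ℚ → x * y ≢ 0ℚ
x*y≢0 {x} {y} x≢0 y≢0 xy≡0 = x≢0 (*-cancelˡ-≡ y≢0 (trans (*-comm y x) (trans xy≡0 (sym (*-zeroʳ y)))))

x*y≢0⇒x≢0 : ∀ {x y} → x * y ≢ 0ℚ → x ≢ 0ℚ
x*y≢0⇒x≢0 {x} {y} xy≢0 x≡0 = xy≢0 (trans (cong (_* y) x≡0) (*-zeroˡ y))

x*y≡1⇒x≢0 : ∀ {x y} → x * y ≡ 1ℚ → x ≢ 0ℚ
x*y≡1⇒x≢0 xy≡1 = x*y≢0⇒x≢0 (λ xy≡0 → 1≢0 (trans (sym xy≡1) xy≡0))

[p⊘r]*r≡p : ∀ p {r} → r ≢ 0ℚ → (p ⊘ r) * r ≡ p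
[p⊘r]*r≡p p {r} r≢0 with r ≟ 0ℚ
... | yes r≡0 = ⊥-elim (r≢0 r≡0)
... | no r≢0′ = begin
  p * 1/ r * r   ≡⟨ *-assoc p (1/ r) r ⟩
  p * (1/ r * r) ≡⟨ cong (p *_) (*-inverseˡ r) ⟩
  p * 1ℚ         ≡⟨ *-identityʳ p ⟩
  p              ∎
  where instance _ = ≢-nonZero r≢0′

linear-combination₅ : ∀ {x y l₁ r₁ l₂ r₂ l₃ r₃ l₄ r₄ l₅ r₅} (c₁ c₂ c₃ c₄ c₅ : ℚ) →
  x - y ≡ c₁ * (l₁ - r₁) ℚ.+ c₂ * (l₂ - r₂) ℚ.+ c₃ * (l₃ - r₃) ℚ.+ c₄ * (l₄ - r₄) ℚ.+ c₅ * (l₅ - r₅) →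
  l₁ ≡ r₁ → l₂ ≡ r₂ → l₃ ≡ r₃ → l₄ ≡ r₄ → l₅ ≡ r₅ → x ≡ y
linear-combination₅ {x} {y} {r₁ = r₁} {r₂ = r₂} {r₃ = r₃} {r₄ = r₄} {r₅ = r₅} c₁ c₂ c₃ c₄ c₅ x-y≡ refl refl refl refl refl =
  x∙y⁻¹≈ε⇒x≈y x y (trans x-y≡ (vanishes c₁ c₂ c₃ c₄ c₅ r₁ r₂ r₃ r₄ r₅))
  where
  vanishes : ∀ c₁ c₂ c₃ c₄ c₅ r₁ r₂ r₃ r₄ r₅ →
    c₁ * (r₁ - r₁) ℚ.+ c₂ * (r₂ - r₂) ℚ.+ c₃ * (r₃ - r₃) ℚ.+ c₄ * (r₄ - r₄) ℚ.+ c₅ * (r₅ - r₅) ≡ 0ℚ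
  vanishes = solve-∀ ℚ-ring

cross-multiply : ∀ {ℓ r z u v w x y t} → u ≢ 0ℚ → v ≢ 0ℚ → w ≢ 0ℚ →
  ℓ * u ≡ x → r * v ≡ y → z * w ≡ t → v * (w * x) ≡ u * (t * y) → ℓ ≡ z * r
cross-multiply {ℓ} {r} {z} {u} {v} {w} u≢0 v≢0 w≢0 refl refl refl eq =
  *-cancelˡ-≡ (x*y≢0 (x*y≢0 u≢0 v≢0) w≢0) (begin
    u * v * w * ℓ           ≡⟨ left ℓ u v w ⟩
    v * (w * (ℓ * u))       ≡⟨ eq ⟩
    u * (z * w * (r * v))   ≡⟨ right r z u v w ⟩
    u * v * w * (z * r)     ∎)
  where
  left : ∀ ℓ u v w → u * v * w * ℓ ≡ v * (w * (ℓ * u))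
  left = solve-∀ ℚ-ring
  right : ∀ r z u v w → u * (z * w * (r * v)) ≡ u * v * w * (z * r)
  right = solve-∀ ℚ-ring

^-distribˡ-+-* : ∀ x m n → x ^ (m + n) ≡ x ^ m * x ^ n
^-distribˡ-+-* x zero    n = sym (*-identityˡ (x ^ n))
^-distribˡ-+-* x (suc m) n = trans (cong (x *_) (^-distribˡ-+-* x m n)) (sym (*-assoc x (x ^ m) (x ^ n)))

^-distribʳ-* : ∀ x y n → (x * y) ^ n ≡ x ^ n * y ^ n
^-distribʳ-* x y zero    = refl
^-distribʳ-* x y (suc n) = trans (cong (x * y *_) (^-distribʳ-* x y n)) (interchange x y (x ^ n) (y ^ n))
  where
  interchange : ∀ x y u v → x * y * (u * v) ≡ x * u * (y * v)
  interchange = solve-∀ ℚ-ring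

1^n≡1 : ∀ n → 1ℚ ^ n ≡ 1ℚ
1^n≡1 zero    = refl
1^n≡1 (suc n) = trans (cong (1ℚ *_) (1^n≡1 n)) (*-identityˡ 1ℚ)

x*y≡1⇒xⁿ*yⁿ≡1 : ∀ {x y} n → x * y ≡ 1ℚ → x ^ n * y ^ n ≡ 1ℚ
x*y≡1⇒xⁿ*yⁿ≡1 {x} {y} n xy≡1 = trans (sym (^-distribʳ-* x y n)) (trans (cong (_^ n) xy≡1) (1^n≡1 n))

x≢0⇒xⁿ≢0 : ∀ {x} n → x ≢ 0ℚ → x ^ n ≢ 0ℚ
x≢0⇒xⁿ≢0 zero    x≢0 = 1≢0
x≢0⇒xⁿ≢0 (suc n) x≢0 = x*y≢0 x≢0 (x≢0⇒xⁿ≢0 n x≢0)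

sumTo-cong-≤ : ∀ n {f g : ℕ → ℚ} → (∀ {k} → k ≤ n → f k ≡ g k) → sumTo n f ≡ sumTo n g
sumTo-cong-≤ zero    f≗g = f≗g z≤n
sumTo-cong-≤ (suc n) f≗g = cong₂ ℚ._+_ (sumTo-cong-≤ n (λ k≤n → f≗g (ℕ.m≤n⇒m≤1+n k≤n))) (f≗g ℕ.≤-refl)

*-distribˡ-sumTo : ∀ n c f → c * sumTo n f ≡ sumTo n (λ k → c * f k)
*-distribˡ-sumTo zero    c f = refl
*-distribˡ-sumTo (suc n) c f = begin
  c * (sumTo n f ℚ.+ f (suc n))        ≡⟨ *-distribˡ-+ c (sumTo n f) (f (suc n)) ⟩
  c * sumTo n f ℚ.+ c * f (suc n)      ≡⟨ cong (ℚ._+ c * f (suc n)) (*-distribˡ-sumTo n c f) ⟩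
  sumTo (suc n) (λ k → c * f k)        ∎

*-distribʳ-sumTo : ∀ n c f → sumTo n f * c ≡ sumTo n (λ k → f k * c)
*-distribʳ-sumTo n c f =
  trans (*-comm (sumTo n f) c) (trans (*-distribˡ-sumTo n c f) (sumTo-cong-≤ n (λ {k} _ → *-comm c (f k))))

sumTo-sub : ∀ n f g → sumTo n (λ k → f k - g k) ≡ sumTo n f - sumTo n g
sumTo-sub zero    f g = refl
sumTo-sub (suc n) f g = begin
  sumTo n (λ k → f k - g k) ℚ.+ (f (suc n) - g (suc n))
    ≡⟨ cong (ℚ._+ (f (suc n) - g (suc n))) (sumTo-sub n f g) ⟩
  sumTo n f - sumTo n g ℚ.+ (f (suc n) - g (suc n))
    ≡⟨ regroup (sumTo n f) (sumTo n g) (f (suc n)) (g (suc n)) ⟩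
  sumTo (suc n) f - sumTo (suc n) g ∎
  where
  regroup : ∀ a b c d → a - b ℚ.+ (c - d) ≡ a ℚ.+ c - (b ℚ.+ d)
  regroup = solve-∀ ℚ-ring

sumTo-suc : ∀ n f → sumTo (suc n) f ≡ f 0 ℚ.+ sumTo n (λ k → f (suc k))
sumTo-suc zero    f = refl
sumTo-suc (suc n) f = begin
  sumTo (suc n) f ℚ.+ f (suc (suc n))
    ≡⟨ cong (ℚ._+ f (suc (suc n))) (sumTo-suc n f) ⟩
  f 0 ℚ.+ sumTo n (λ k → f (suc k)) ℚ.+ f (suc (suc n))
    ≡⟨ +-assoc (f 0) (sumTo n (λ k → f (suc k))) (f (suc (suc n))) ⟩
  f 0 ℚ.+ sumTo (suc n) (λ k → f (suc k)) ∎

poch-+ : ∀ x q k m → poch x q (k + m) ≡ poch x q k * poch (x * q ^ k) q m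
poch-+ x q k zero    = trans (cong (poch x q) (ℕ.+-identityʳ k)) (sym (*-identityʳ (poch x q k)))
poch-+ x q k (suc m) = begin
  poch x q (k + suc m)
    ≡⟨ cong (poch x q) (ℕ.+-suc k m) ⟩
  poch x q (k + m) * (1ℚ - x * q ^ (k + m))
    ≡⟨ cong₂ (λ p r → p * (1ℚ - x * r)) (poch-+ x q k m) (^-distribˡ-+-* q k m) ⟩
  poch x q k * poch (x * q ^ k) q m * (1ℚ - x * (q ^ k * q ^ m))
    ≡⟨ regroup (poch x q k) (poch (x * q ^ k) q m) x (q ^ k) (q ^ m) ⟩
  poch x q k * poch (x * q ^ k) q (suc m) ∎
  where
  regroup : ∀ p r x u v → p * r * (1ℚ - x * (u * v)) ≡ p * (r * (1ℚ - x * u * v))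
  regroup = solve-∀ ℚ-ring

poch-suc-head : ∀ x q t → poch x q (suc t) ≡ (1ℚ - x) * poch (x * q) q t
poch-suc-head x q t =
  trans (poch-+ x q 1 t) (cong₂ (λ u y → u * poch y q t) (first x) (cong (x *_) (*-identityʳ q)))
  where
  first : ∀ x → 1ℚ * (1ℚ - x * 1ℚ) ≡ 1ℚ - x
  first = solve-∀ ℚ-ring

poch≢0-≤ : ∀ {x q n k} → k ≤ n → poch x q n ≢ 0ℚ → poch x q k ≢ 0ℚ
poch≢0-≤ {x} {q} {n} {k} k≤n xₙ≢0 = x*y≢0⇒x≢0 (subst (_≢ 0ℚ) split xₙ≢0)
  where
  split : poch x q n ≡ poch x q k * poch (x * q ^ k) q (n ∸ k)
  split = trans (cong (poch x q) (sym (ℕ.m+[n∸m]≡n k≤n))) (poch-+ x q k (n ∸ k))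

-- aᵗ (c/a; q)_t without the division by a.
hpoch : ℚ → ℚ → ℚ → ℕ → ℚ
hpoch a c q zero    = 1ℚ
hpoch a c q (suc t) = hpoch a c q t * (a - c * q ^ t)

hpoch-+ : ∀ a c q k t → hpoch a c q (k + t) ≡ hpoch a c q k * hpoch a (c * q ^ k) q t
hpoch-+ a c q k zero    = trans (cong (hpoch a c q) (ℕ.+-identityʳ k)) (sym (*-identityʳ (hpoch a c q k)))
hpoch-+ a c q k (suc t) = begin
  hpoch a c q (k + suc t)
    ≡⟨ cong (hpoch a c q) (ℕ.+-suc k t) ⟩
  hpoch a c q (k + t) * (a - c * q ^ (k + t))
    ≡⟨ cong₂ (λ h r → h * (a - c * r)) (hpoch-+ a c q k t) (^-distribˡ-+-* q k t) ⟩
  hpoch a c q k * hpoch a (c * q ^ k) q t * (a - c * (q ^ k * q ^ t))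
    ≡⟨ regroup (hpoch a c q k) (hpoch a (c * q ^ k) q t) a c (q ^ k) (q ^ t) ⟩
  hpoch a c q k * hpoch a (c * q ^ k) q (suc t) ∎
  where
  regroup : ∀ h g a c u v → h * g * (a - c * (u * v)) ≡ h * (g * (a - c * u * v))
  regroup = solve-∀ ℚ-ring

hpoch-* : ∀ x a c q t → hpoch (x * a) (x * c) q t ≡ x ^ t * hpoch a c q t
hpoch-* x a c q zero    = sym (*-identityˡ 1ℚ)
hpoch-* x a c q (suc t) = begin
  hpoch (x * a) (x * c) q t * (x * a - x * c * q ^ t)
    ≡⟨ cong (_* (x * a - x * c * q ^ t)) (hpoch-* x a c q t) ⟩
  x ^ t * hpoch a c q t * (x * a - x * c * q ^ t)
    ≡⟨ regroup x (x ^ t) (hpoch a c q t) a c (q ^ t) ⟩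
  x ^ suc t * hpoch a c q (suc t) ∎
  where
  regroup : ∀ x y h a c u → y * h * (x * a - x * c * u) ≡ x * y * (h * (a - c * u))
  regroup = solve-∀ ℚ-ring

^*poch≡hpoch : ∀ {a b c} q t → a * b ≡ c → a ^ t * poch b q t ≡ hpoch a c q t
^*poch≡hpoch q zero ab≡c = *-identityˡ 1ℚ
^*poch≡hpoch {a} {b} {c} q (suc t) ab≡c = begin
  a * a ^ t * (poch b q t * (1ℚ - b * q ^ t))
    ≡⟨ regroup a (a ^ t) (poch b q t) b (q ^ t) ⟩
  a ^ t * poch b q t * (a - a * b * q ^ t)
    ≡⟨ cong₂ (λ h v → h * (a - v * q ^ t)) (^*poch≡hpoch q t ab≡c) ab≡c ⟩
  hpoch a c q (suc t) ∎
  where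
  regroup : ∀ a y p b u → a * y * (p * (1ℚ - b * u)) ≡ y * p * (a - a * b * u)
  regroup = solve-∀ ℚ-ring

hpoch-1 : ∀ c q t → hpoch 1ℚ c q t ≡ poch c q t
hpoch-1 c q zero    = refl
hpoch-1 c q (suc t) = cong (_* (1ℚ - c * q ^ t)) (hpoch-1 c q t)

hpoch≢0 : ∀ {a b c} q n → a ≢ 0ℚ → poch b q n ≢ 0ℚ → a * b ≡ c → hpoch a c q n ≢ 0ℚ
hpoch≢0 q n a≢0 bₙ≢0 ab≡c = subst (_≢ 0ℚ) (^*poch≡hpoch q n ab≡c) (x*y≢0 (x≢0⇒xⁿ≢0 n a≢0) bₙ≢0)

infixr 8 _^choose₂_
_^choose₂_ : ℚ → ℕ → ℚ
q ^choose₂ zero  = 1ℚ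
q ^choose₂ suc n = q ^choose₂ n * q ^ n

q≢0⇒q^choose₂n≢0 : ∀ {q} n → q ≢ 0ℚ → q ^choose₂ n ≢ 0ℚ
q≢0⇒q^choose₂n≢0 zero    q≢0 = 1≢0
q≢0⇒q^choose₂n≢0 (suc n) q≢0 = x*y≢0 (q≢0⇒q^choose₂n≢0 n q≢0) (x≢0⇒xⁿ≢0 n q≢0)

-- Pairing factor j of hpoch with factor n-1-j of (u; q)_n: c qʲ (1 - u q^(n-1-j)) = -(a - c qʲ) as u c q^(n-1) = a.
poch-reverse : ∀ {q} n u c a → q ≢ 0ℚ → u * c * q ^ n ≡ a * q →
  c ^ n * poch u q n * q ^choose₂ n ≡ (- 1ℚ) ^ n * hpoch a c q n
poch-reverse zero    u c a q≢0 ucqⁿ≡aq = refl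
poch-reverse {q} (suc n) u c a q≢0 ucqⁿ⁺¹≡aq = begin
  c * c ^ n * poch u q (suc n) * (q ^choose₂ n * q ^ n)
    ≡⟨ cong (λ p → c * c ^ n * p * (q ^choose₂ n * q ^ n)) (poch-suc-head u q n) ⟩
  c * c ^ n * ((1ℚ - u) * poch (u * q) q n) * (q ^choose₂ n * q ^ n)
    ≡⟨ regroup c (c ^ n) u (poch (u * q) q n) (q ^choose₂ n) (q ^ n) ⟩
  (c * q ^ n - u * c * q ^ n) * (c ^ n * poch (u * q) q n * q ^choose₂ n)
    ≡⟨ cong₂ (λ v w → (c * q ^ n - v) * w) ucqⁿ≡a (poch-reverse n (u * q) c a q≢0 uqcqⁿ≡aq) ⟩
  (c * q ^ n - a) * ((- 1ℚ) ^ n * hpoch a c q n)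
    ≡⟨ flip-sign c a (q ^ n) ((- 1ℚ) ^ n) (hpoch a c q n) ⟩
  (- 1ℚ) ^ suc n * hpoch a c q (suc n) ∎
  where
  regroup : ∀ c y u p t v → c * y * ((1ℚ - u) * p) * (t * v) ≡ (c * v - u * c * v) * (y * p * t)
  regroup = solve-∀ ℚ-ring
  flip-sign : ∀ c a v s h → (c * v - a) * (s * h) ≡ - 1ℚ * s * (h * (a - c * v))
  flip-sign = solve-∀ ℚ-ring
  commute : ∀ u c q v → u * c * (q * v) ≡ q * (u * c * v)
  commute = solve-∀ ℚ-ring
  ucqⁿ≡a : u * c * q ^ n ≡ a
  ucqⁿ≡a = *-cancelˡ-≡ q≢0 (trans (sym (commute u c q (q ^ n))) (trans ucqⁿ⁺¹≡aq (*-comm a q)))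
  uqcqⁿ≡aq : u * q * c * q ^ n ≡ a * q
  uqcqⁿ≡aq = trans (shift u c q (q ^ n)) ucqⁿ⁺¹≡aq
    where
    shift : ∀ u c q v → u * q * c * v ≡ u * c * (q * v)
    shift = solve-∀ ℚ-ring

summand : ℚ → ℕ → ℚ → ℚ → ℚ → ℕ → ℚ
summand q n a b c k =
  ((poch (1ℚ ⊘ q ^ n) q k * poch c q (k + k)) ⊘ (poch q q k * poch (a * q) q k * poch b q k)) * q ^ k

module Cleared (q q⁻¹ : ℚ) (q*q⁻¹≡1 : q * q⁻¹ ≡ 1ℚ) where

  q≢0 : q ≢ 0ℚ
  q≢0 = x*y≡1⇒x≢0 q*q⁻¹≡1

  -- The coefficient of zᵏ in ∏_{i<n} (1 - z q⁻ⁱ); by weight-poch it is (q⁻ⁿ; q)_k qᵏ / (q; q)_k.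
  weight : ℕ → ℕ → ℚ
  weight n       zero    = 1ℚ
  weight zero    (suc k) = 0ℚ
  weight (suc n) (suc k) = weight n (suc k) - q⁻¹ ^ n * weight n k

  weight-vanishes : ∀ {n k} → n < k → weight n k ≡ 0ℚ
  weight-vanishes {zero}  {suc k} _          = refl
  weight-vanishes {suc n} {suc k} (s≤s n<k) = begin
    weight n (suc k) - q⁻¹ ^ n * weight n k
      ≡⟨ cong₂ (λ u v → u - q⁻¹ ^ n * v) (weight-vanishes (ℕ.m≤n⇒m≤1+n n<k)) (weight-vanishes n<k) ⟩
    0ℚ - q⁻¹ ^ n * 0ℚ
      ≡⟨ zero-sub (q⁻¹ ^ n) ⟩
    0ℚ ∎
    where
    zero-sub : ∀ x → 0ℚ - x * 0ℚ ≡ 0ℚ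
    zero-sub = solve-∀ ℚ-ring

  weight-poch : ∀ n k → weight n k * poch q q k ≡ poch (q⁻¹ ^ n) q k * q ^ k
  weight-poch n       zero    = refl
  weight-poch zero    (suc k) = begin
    0ℚ * poch q q (suc k)                          ≡⟨ vanish (poch q q (suc k)) (poch (1ℚ * q) q k) (q ^ suc k) ⟩
    (1ℚ - 1ℚ) * poch (1ℚ * q) q k * q ^ suc k      ≡⟨ cong (_* q ^ suc k) (poch-suc-head 1ℚ q k) ⟨
    poch 1ℚ q (suc k) * q ^ suc k                  ∎
    where
    vanish : ∀ x p y → 0ℚ * x ≡ (1ℚ - 1ℚ) * p * y
    vanish = solve-∀ ℚ-ring
  weight-poch (suc n) (suc k) = begin
    (weight n (suc k) - I * weight n k) * (poch q q k * (1ℚ - q * q ^ k))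
      ≡⟨ expand (weight n (suc k)) (weight n k) I (poch q q k) q (q ^ k) ⟩
    weight n (suc k) * poch q q (suc k) - I * (1ℚ - q * q ^ k) * (weight n k * poch q q k)
      ≡⟨ cong₂ (λ u v → u - I * (1ℚ - q * q ^ k) * v) (weight-poch n (suc k)) (weight-poch n k) ⟩
    poch I q k * (1ℚ - I * q ^ k) * (q * q ^ k) - I * (1ℚ - q * q ^ k) * (poch I q k * q ^ k)
      ≡⟨ collect (poch I q k) I q (q ^ k) ⟩
    poch I q k * q ^ k * (q - 1ℚ * I)
      ≡⟨ cong (λ x → poch I q k * q ^ k * (q - x * I)) q*q⁻¹≡1 ⟨
    poch I q k * q ^ k * (q - q * q⁻¹ * I)
      ≡⟨ factor (poch I q k) (q ^ k) q q⁻¹ I ⟩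
    (1ℚ - q⁻¹ * I) * poch I q k * q ^ suc k
      ≡⟨ cong (λ x → (1ℚ - q⁻¹ * I) * poch x q k * q ^ suc k) q⁻¹Iq≡I ⟨
    (1ℚ - q⁻¹ * I) * poch (q⁻¹ * I * q) q k * q ^ suc k
      ≡⟨ cong (_* q ^ suc k) (poch-suc-head (q⁻¹ * I) q k) ⟨
    poch (q⁻¹ ^ suc n) q (suc k) * q ^ suc k ∎
    where
    I = q⁻¹ ^ n
    expand : ∀ w w′ i p q u → (w - i * w′) * (p * (1ℚ - q * u)) ≡ w * (p * (1ℚ - q * u)) - i * (1ℚ - q * u) * (w′ * p)
    expand = solve-∀ ℚ-ring
    collect : ∀ p i q u → p * (1ℚ - i * u) * (q * u) - i * (1ℚ - q * u) * (p * u) ≡ p * u * (q - 1ℚ * i)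
    collect = solve-∀ ℚ-ring
    factor : ∀ p u q j i → p * u * (q - q * j * i) ≡ (1ℚ - j * i) * p * (q * u)
    factor = solve-∀ ℚ-ring
    q⁻¹Iq≡I : q⁻¹ * I * q ≡ I
    q⁻¹Iq≡I = trans (swap q⁻¹ I q) (trans (cong (_* I) q*q⁻¹≡1) (*-identityˡ I))
      where
      swap : ∀ j i q → j * i * q ≡ q * j * i
      swap = solve-∀ ℚ-ring

  sumTo-weight-suc : ∀ m (f : ℕ → ℚ) →
    sumTo (suc m) (λ k → weight (suc m) k * f k)
      ≡ sumTo (suc m) (λ k → weight m k * f k) - q⁻¹ ^ m * sumTo m (λ k → weight m k * f (suc k))
  sumTo-weight-suc m f = begin
    sumTo (suc m) (λ k → weight (suc m) k * f k)
      ≡⟨ sumTo-suc m (λ k → weight (suc m) k * f k) ⟩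
    1ℚ * f 0 ℚ.+ sumTo m (λ k → (weight m (suc k) - q⁻¹ ^ m * weight m k) * f (suc k))
      ≡⟨ cong (1ℚ * f 0 ℚ.+_) split ⟩
    1ℚ * f 0 ℚ.+ (A - sumTo m (λ k → q⁻¹ ^ m * (weight m k * f (suc k))))
      ≡⟨ cong (λ x → 1ℚ * f 0 ℚ.+ (A - x)) (*-distribˡ-sumTo m (q⁻¹ ^ m) (λ k → weight m k * f (suc k))) ⟨
    1ℚ * f 0 ℚ.+ (A - q⁻¹ ^ m * B)
      ≡⟨ +-sub-assoc (1ℚ * f 0) A (q⁻¹ ^ m * B) ⟩
    1ℚ * f 0 ℚ.+ A - q⁻¹ ^ m * B
      ≡⟨ cong (_- q⁻¹ ^ m * B) (sumTo-suc m (λ k → weight m k * f k)) ⟨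
    sumTo (suc m) (λ k → weight m k * f k) - q⁻¹ ^ m * B ∎
    where
    A = sumTo m (λ k → weight m (suc k) * f (suc k))
    B = sumTo m (λ k → weight m k * f (suc k))
    distrib : ∀ w i w′ x → (w - i * w′) * x ≡ w * x - i * (w′ * x)
    distrib = solve-∀ ℚ-ring
    split : sumTo m (λ k → (weight m (suc k) - q⁻¹ ^ m * weight m k) * f (suc k))
              ≡ A - sumTo m (λ k → q⁻¹ ^ m * (weight m k * f (suc k)))
    split = trans (sumTo-cong-≤ m (λ {k} _ → distrib (weight m (suc k)) (q⁻¹ ^ m) (weight m k) (f (suc k))))
                  (sumTo-sub m (λ k → weight m (suc k) * f (suc k)) (λ k → q⁻¹ ^ m * (weight m k * f (suc k))))
    +-sub-assoc : ∀ x y z → x ℚ.+ (y - z) ≡ x ℚ.+ y - z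
    +-sub-assoc = solve-∀ ℚ-ring

  sumTo-weight-extend : ∀ m (f : ℕ → ℚ) → sumTo (suc m) (λ k → weight m k * f k) ≡ sumTo m (λ k → weight m k * f k)
  sumTo-weight-extend m f = begin
    sumTo m (λ k → weight m k * f k) ℚ.+ weight m (suc m) * f (suc m)
      ≡⟨ cong (λ w → sumTo m (λ k → weight m k * f k) ℚ.+ w * f (suc m)) (weight-vanishes {m} {suc m} ℕ.≤-refl) ⟩
    sumTo m (λ k → weight m k * f k) ℚ.+ 0ℚ * f (suc m)
      ≡⟨ drop (sumTo m (λ k → weight m k * f k)) (f (suc m)) ⟩
    sumTo m (λ k → weight m k * f k) ∎
    where
    drop : ∀ s x → s ℚ.+ 0ℚ * x ≡ s
    drop = solve-∀ ℚ-ring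

  term : ℚ → ℚ → ℕ → ℕ → ℚ
  term a c k t = poch c q (k + k) * poch (a * q ^ suc k) q t * a ^ k * hpoch a (c * q ^ k) q t

  -- Σ_k summand q n a b c k times (aq; q)_n aⁿ (b; q)_n when a b = c (sumTo-summand-cleared), as a polynomial.
  Φ : ℕ → ℚ → ℚ → ℚ
  Φ n a c = sumTo n (λ k → weight n k * term a c k (n ∸ k))

  term-suc : ∀ {k m} a c → k ≤ m →
    term a c k (suc m ∸ k) ≡ (1ℚ - a * q ^ suc m) * (a - c * q ^ m) * term a c k (m ∸ k)
  term-suc {k} {m} a c k≤m = begin
    term a c k (suc m ∸ k)
      ≡⟨ cong (term a c k) (ℕ.+-∸-assoc 1 k≤m) ⟩
    term a c k (suc t)
      ≡⟨ regroup (poch c q (k + k)) (poch (a * q ^ suc k) q t) (a ^ k) (hpoch a (c * q ^ k) q t) a c q (q ^ k) (q ^ t) ⟩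
    (1ℚ - a * (q * (q ^ k * q ^ t))) * (a - c * (q ^ k * q ^ t)) * term a c k t
      ≡⟨ cong (λ x → (1ℚ - a * (q * x)) * (a - c * x) * term a c k t) qᵏqᵗ≡qᵐ ⟩
    (1ℚ - a * q ^ suc m) * (a - c * q ^ m) * term a c k t ∎
    where
    t = m ∸ k
    qᵏqᵗ≡qᵐ : q ^ k * q ^ t ≡ q ^ m
    qᵏqᵗ≡qᵐ = trans (sym (^-distribˡ-+-* q k t)) (cong (q ^_) (ℕ.m+[n∸m]≡n k≤m))
    regroup : ∀ C P A H a c q u v →
      C * (P * (1ℚ - a * (q * u) * v)) * A * (H * (a - c * u * v)) ≡ (1ℚ - a * (q * (u * v))) * (a - c * (u * v)) * (C * P * A * H)
    regroup = solve-∀ ℚ-ring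

  term-shift : ∀ {j m} a c → j ≤ m →
    q ^ m * term a c (suc j) (m ∸ j) ≡ a * (1ℚ - c) * (1ℚ - c * q) * term (a * q) (c * q * q) j (m ∸ j)
  term-shift {j} {m} a c j≤m = begin
    q ^ m * (poch c q (suc j + suc j) * poch (a * q ^ suc (suc j)) q t * a ^ suc j * hpoch a (c * q ^ suc j) q t)
      ≡⟨ cong₂ _*_ qᵐ≡qʲqᵗ (cong₂ (λ C′ P′ → C′ * P′ * a ^ suc j * hpoch a (c * q ^ suc j) q t)
                                 c₂ⱼ₊₂-split (cong (λ x → poch x q t) (sym (*-assoc a q (q ^ suc j))))) ⟩
    q ^ j * q ^ t * ((1ℚ - c) * (1ℚ - c * q) * C * P * (a * a ^ j) * hpoch a (c * q ^ suc j) q t)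
      ≡⟨ regroup (q ^ j) (q ^ t) a c q C P (a ^ j) (hpoch a (c * q ^ suc j) q t) ⟩
    a * (1ℚ - c) * (1ℚ - c * q) * (C * P * (a ^ j * q ^ j) * (q ^ t * hpoch a (c * q ^ suc j) q t))
      ≡⟨ cong₂ (λ x h → a * (1ℚ - c) * (1ℚ - c * q) * (C * P * x * h)) (^-distribʳ-* a q j) hpoch-shift ⟨
    a * (1ℚ - c) * (1ℚ - c * q) * term (a * q) (c * q * q) j t ∎
    where
    t = m ∸ j
    C = poch (c * q * q) q (j + j)
    P = poch (a * q * q ^ suc j) q t
    qᵐ≡qʲqᵗ : q ^ m ≡ q ^ j * q ^ t
    qᵐ≡qʲqᵗ = trans (cong (q ^_) (sym (ℕ.m+[n∸m]≡n j≤m))) (^-distribˡ-+-* q j t)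
    c₂ⱼ₊₂-split : poch c q (suc j + suc j) ≡ (1ℚ - c) * (1ℚ - c * q) * C
    c₂ⱼ₊₂-split = begin
      poch c q (suc j + suc j)                        ≡⟨ cong (λ i → poch c q (suc i)) (ℕ.+-suc j j) ⟩
      poch c q (suc (suc (j + j)))                    ≡⟨ poch-suc-head c q (suc (j + j)) ⟩
      (1ℚ - c) * poch (c * q) q (suc (j + j))         ≡⟨ cong ((1ℚ - c) *_) (poch-suc-head (c * q) q (j + j)) ⟩
      (1ℚ - c) * ((1ℚ - c * q) * C)                   ≡⟨ *-assoc (1ℚ - c) (1ℚ - c * q) C ⟨
      (1ℚ - c) * (1ℚ - c * q) * C                     ∎
    hpoch-shift : hpoch (a * q) (c * q * q * q ^ j) q t ≡ q ^ t * hpoch a (c * q ^ suc j) q t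
    hpoch-shift = trans (cong₂ (λ x y → hpoch x y q t) (*-comm a q) (rotate c q (q ^ j))) (hpoch-* q a (c * q ^ suc j) q t)
      where
      rotate : ∀ c q u → c * q * q * u ≡ q * (c * (q * u))
      rotate = solve-∀ ℚ-ring
    regroup : ∀ Qj Qt a c q C P A H →
      Qj * Qt * ((1ℚ - c) * (1ℚ - c * q) * C * P * (a * A) * H) ≡ a * (1ℚ - c) * (1ℚ - c * q) * (C * P * (A * Qj) * (Qt * H))
    regroup = solve-∀ ℚ-ring

  shifted : ℕ → ℚ → ℚ → ℚ
  shifted m a c = sumTo m (λ j → weight m j * term a c (suc j) (m ∸ j))

  Φ-suc : ∀ m a c → Φ (suc m) a c ≡ (1ℚ - a * q ^ suc m) * (a - c * q ^ m) * Φ m a c - q⁻¹ ^ m * shifted m a c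
  Φ-suc m a c = begin
    Φ (suc m) a c
      ≡⟨ sumTo-weight-suc m (λ k → term a c k (suc m ∸ k)) ⟩
    sumTo (suc m) (λ k → weight m k * term a c k (suc m ∸ k)) - q⁻¹ ^ m * shifted m a c
      ≡⟨ cong (_- q⁻¹ ^ m * shifted m a c) (trans (sumTo-weight-extend m (λ k → term a c k (suc m ∸ k))) (sumTo-cong-≤ m step)) ⟩
    sumTo m (λ k → F * (weight m k * term a c k (m ∸ k))) - q⁻¹ ^ m * shifted m a c
      ≡⟨ cong (_- q⁻¹ ^ m * shifted m a c) (*-distribˡ-sumTo m F (λ k → weight m k * term a c k (m ∸ k))) ⟨
    F * Φ m a c - q⁻¹ ^ m * shifted m a c ∎
    where
    F = (1ℚ - a * q ^ suc m) * (a - c * q ^ m)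
    step : ∀ {k} → k ≤ m → weight m k * term a c k (suc m ∸ k) ≡ F * (weight m k * term a c k (m ∸ k))
    step {k} k≤m = trans (cong (weight m k *_) (term-suc a c k≤m)) (swap (weight m k) F (term a c k (m ∸ k)))
      where
      swap : ∀ w f x → w * (f * x) ≡ f * (w * x)
      swap = solve-∀ ℚ-ring

  qᵐ*shifted : ∀ m a c → q ^ m * shifted m a c ≡ a * (1ℚ - c) * (1ℚ - c * q) * Φ m (a * q) (c * q * q)
  qᵐ*shifted m a c = begin
    q ^ m * shifted m a c
      ≡⟨ *-distribˡ-sumTo m (q ^ m) (λ j → weight m j * term a c (suc j) (m ∸ j)) ⟩
    sumTo m (λ j → q ^ m * (weight m j * term a c (suc j) (m ∸ j)))
      ≡⟨ sumTo-cong-≤ m step ⟩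
    sumTo m (λ j → G * (weight m j * term (a * q) (c * q * q) j (m ∸ j)))
      ≡⟨ *-distribˡ-sumTo m G (λ j → weight m j * term (a * q) (c * q * q) j (m ∸ j)) ⟨
    G * Φ m (a * q) (c * q * q) ∎
    where
    G = a * (1ℚ - c) * (1ℚ - c * q)
    swap : ∀ u v x → u * (v * x) ≡ v * (u * x)
    swap = solve-∀ ℚ-ring
    step : ∀ {j} → j ≤ m → q ^ m * (weight m j * term a c (suc j) (m ∸ j)) ≡ G * (weight m j * term (a * q) (c * q * q) j (m ∸ j))
    step {j} j≤m = begin
      q ^ m * (weight m j * term a c (suc j) (m ∸ j))     ≡⟨ swap (q ^ m) (weight m j) _ ⟩
      weight m j * (q ^ m * term a c (suc j) (m ∸ j))     ≡⟨ cong (weight m j *_) (term-shift a c j≤m) ⟩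
      weight m j * (G * term (a * q) (c * q * q) j (m ∸ j)) ≡⟨ swap (weight m j) G _ ⟩
      G * (weight m j * term (a * q) (c * q * q) j (m ∸ j)) ∎

  Φ-contiguous₁ : ∀ m a c →
    q ^ m * q ^ m * Φ (suc m) a c
      ≡ q ^ m * q ^ m * ((1ℚ - a * q ^ suc m) * (a - c * q ^ m) * Φ m a c) - a * (1ℚ - c) * (1ℚ - c * q) * Φ m (a * q) (c * q * q)
  Φ-contiguous₁ m a c = begin
    q ^ m * q ^ m * Φ (suc m) a c
      ≡⟨ cong (q ^ m * q ^ m *_) (Φ-suc m a c) ⟩
    q ^ m * q ^ m * (X - q⁻¹ ^ m * shifted m a c)
      ≡⟨ distribute (q ^ m) (q⁻¹ ^ m) X (shifted m a c) ⟩
    q ^ m * q ^ m * X - q ^ m * q⁻¹ ^ m * (q ^ m * shifted m a c)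
      ≡⟨ cong₂ (λ u v → q ^ m * q ^ m * X - u * v) (x*y≡1⇒xⁿ*yⁿ≡1 m q*q⁻¹≡1) (qᵐ*shifted m a c) ⟩
    q ^ m * q ^ m * X - 1ℚ * (a * (1ℚ - c) * (1ℚ - c * q) * Φ m (a * q) (c * q * q))
      ≡⟨ cong (λ x → q ^ m * q ^ m * X - x) (*-identityˡ _) ⟩
    q ^ m * q ^ m * X - a * (1ℚ - c) * (1ℚ - c * q) * Φ m (a * q) (c * q * q) ∎
    where
    X = (1ℚ - a * q ^ suc m) * (a - c * q ^ m) * Φ m a c
    distribute : ∀ Q J X S → Q * Q * (X - J * S) ≡ Q * Q * X - Q * J * (Q * S)
    distribute = solve-∀ ℚ-ring

  Φ-contiguous₂ : ∀ m a c →
    q ^ m * Φ (suc m) a c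
      ≡ - (q ^ m * c * (1ℚ - c) * (1ℚ - a * q ^ suc m)) * Φ m a (c * q) - (a * q - c * q ^ m) * (a - c * q ^ m) * Φ m (a * q) c
  Φ-contiguous₂ zero a c = trans (Φ-contiguous₁ 0 a c) (base a c q)
    where
    base : ∀ a c q →
      1ℚ * 1ℚ * ((1ℚ - a * (q * 1ℚ)) * (a - c * 1ℚ) * 1ℚ) - a * (1ℚ - c) * (1ℚ - c * q) * 1ℚ
        ≡ - (1ℚ * c * (1ℚ - c) * (1ℚ - a * (q * 1ℚ))) * 1ℚ - (a * q - c * 1ℚ) * (a - c * 1ℚ) * 1ℚ
    base = solve-∀ ℚ-ring
  -- Reduce both sides to level m: the left by Φ-contiguous₁ and then induction, the right by
  -- Φ-contiguous₁ at (a, cq) and (aq, c).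
  Φ-contiguous₂ (suc m) a c = *-cancelˡ-≡ (x*y≢0 (x*y≢0 (x*y≢0 q≢0 Q≢0) Q≢0) Q≢0) (linear-combination₅
      (Q * Q)
      (q * Q * (q * Q) * (1ℚ - a * (q * (q * Q))) * (a - c * (q * Q)) * Q)
      (- (a * (1ℚ - c) * (1ℚ - c * q) * Q))
      (q * Q * (q * Q) * c * (1ℚ - c) * (1ℚ - a * (q * (q * Q))))
      (q * Q * (a * q - c * (q * Q)) * (a - c * (q * Q)))
      (identity q Q a c (Φ (suc (suc m)) a c) (Φ (suc m) a c) (Φ (suc m) (a * q) (c * q * q)) (Φ (suc m) a (c * q)) (Φ (suc m) (a * q) c)
                (Φ m a (c * q)) (Φ m (a * q) c) (Φ m (a * q) (c * q * q * q)) (Φ m (a * q * q) (c * q * q)))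
      (Φ-contiguous₁ (suc m) a c) (Φ-contiguous₂ m a c) (Φ-contiguous₂ m (a * q) (c * q * q))
      (Φ-contiguous₁ m a (c * q)) (Φ-contiguous₁ m (a * q) c))
    where
    Q = q ^ m
    Q≢0 = x≢0⇒xⁿ≢0 m q≢0
    identity : ∀ q Q a c S S₁ S₂ S₃ S₄ T₁ T₂ T₃ T₄ →
      q * Q * Q * Q * (q * Q * S)
        - q * Q * Q * Q * (- (q * Q * c * (1ℚ - c) * (1ℚ - a * (q * (q * Q)))) * S₃ - (a * q - c * (q * Q)) * (a - c * (q * Q)) * S₄)
      ≡ Q * Q * (q * Q * (q * Q) * S - (q * Q * (q * Q) * ((1ℚ - a * (q * (q * Q))) * (a - c * (q * Q)) * S₁) - a * (1ℚ - c) * (1ℚ - c * q) * S₂))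
        ℚ.+ q * Q * (q * Q) * (1ℚ - a * (q * (q * Q))) * (a - c * (q * Q)) * Q
            * (Q * S₁ - (- (Q * c * (1ℚ - c) * (1ℚ - a * (q * Q))) * T₁ - (a * q - c * Q) * (a - c * Q) * T₂))
        ℚ.+ - (a * (1ℚ - c) * (1ℚ - c * q) * Q)
            * (Q * S₂ - (- (Q * (c * q * q) * (1ℚ - c * q * q) * (1ℚ - a * q * (q * Q))) * T₃
                         - (a * q * q - c * q * q * Q) * (a * q - c * q * q * Q) * T₄))
        ℚ.+ q * Q * (q * Q) * c * (1ℚ - c) * (1ℚ - a * (q * (q * Q)))
            * (Q * Q * S₃ - (Q * Q * ((1ℚ - a * (q * Q)) * (a - c * q * Q) * T₁) - a * (1ℚ - c * q) * (1ℚ - c * q * q) * T₃))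
        ℚ.+ q * Q * (a * q - c * (q * Q)) * (a - c * (q * Q))
            * (Q * Q * S₄ - (Q * Q * ((1ℚ - a * q * (q * Q)) * (a * q - c * Q) * T₂) - a * q * (1ℚ - c) * (1ℚ - c * q) * T₄))
    identity = solve-∀ ℚ-ring

  Φ-symmetry : ∀ n a c d → c * d * q ^ n ≡ a * q →
    c ^ n * c ^ n * (q ^choose₂ n * q ^choose₂ n) * Φ n a d ≡ a ^ n * Φ n a c
  Φ-symmetry zero    a c d _          = refl
  -- Expand both sides by the contiguous relations; the level-m values then match by induction at
  -- (a, cq, d) and (aq, c, dq²), and what is left is a multiple of c d q^(m+1) - a q.
  Φ-symmetry (suc m) a c d cdqᵐ⁺¹≡aq = *-cancelˡ-≡ (x*y≢0 q≢0 (x≢0⇒xⁿ≢0 m q≢0)) (linear-combination₅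
      (q * c * c * C * C * T * T * Q)
      (- (q * a * A))
      (q * c * c * Q * (1ℚ - a * (q * Q)) * (a - d * Q))
      (- (q * c * c * Q * a * (1ℚ - d) * (1ℚ - d * q)))
      (- (c * Q * A * (1ℚ - a * (q * Q)) * T₁ ℚ.+ a * A * (q * (a ℚ.+ c * d * Q) - c * Q * (1ℚ ℚ.+ q)) * T₂))
      (identity q Q a c d C A T (Φ (suc m) a d) (Φ (suc m) a c) U₁ U₂ T₁ T₂)
      (Φ-contiguous₁ m a d) (Φ-contiguous₂ m a c) IH₁ IH₂ cdqᵐ⁺¹≡aq)
    where
    Q = q ^ m
    C = c ^ m
    A = a ^ m
    T = q ^choose₂ m
    U₁ = Φ m a d
    U₂ = Φ m (a * q) (d * q * q)
    T₁ = Φ m a (c * q)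
    T₂ = Φ m (a * q) c
    IH₁ : C * Q * (C * Q) * (T * T) * U₁ ≡ A * T₁
    IH₁ = trans (cong (λ x → x * x * (T * T) * U₁) (sym (^-distribʳ-* c q m)))
                (Φ-symmetry m a (c * q) d (trans (rotate c d q Q) cdqᵐ⁺¹≡aq))
      where
      rotate : ∀ c d q Q → c * q * d * Q ≡ c * d * (q * Q)
      rotate = solve-∀ ℚ-ring
    IH₂ : C * C * (T * T) * U₂ ≡ A * Q * T₂
    IH₂ = trans (Φ-symmetry m (a * q) c (d * q * q) (trans (rotate c d q Q) (cong (_* q) cdqᵐ⁺¹≡aq)))
                (cong (_* T₂) (^-distribʳ-* a q m))
      where
      rotate : ∀ c d q Q → c * (d * q * q) * Q ≡ c * d * (q * Q) * q
      rotate = solve-∀ ℚ-ring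
    identity : ∀ q Q a c d C A T S S′ U₁ U₂ T₁ T₂ →
      q * Q * (c * C * (c * C) * (T * Q * (T * Q)) * S) - q * Q * (a * A * S′)
      ≡ q * c * c * C * C * T * T * Q
          * (Q * Q * S - (Q * Q * ((1ℚ - a * (q * Q)) * (a - d * Q) * U₁) - a * (1ℚ - d) * (1ℚ - d * q) * U₂))
        ℚ.+ - (q * a * A)
          * (Q * S′ - (- (Q * c * (1ℚ - c) * (1ℚ - a * (q * Q))) * T₁ - (a * q - c * Q) * (a - c * Q) * T₂))
        ℚ.+ q * c * c * Q * (1ℚ - a * (q * Q)) * (a - d * Q)
          * (C * Q * (C * Q) * (T * T) * U₁ - A * T₁)
        ℚ.+ - (q * c * c * Q * a * (1ℚ - d) * (1ℚ - d * q))
          * (C * C * (T * T) * U₂ - A * Q * T₂)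
        ℚ.+ - (c * Q * A * (1ℚ - a * (q * Q)) * T₁ ℚ.+ a * A * (q * (a ℚ.+ c * d * Q) - c * Q * (1ℚ ℚ.+ q)) * T₂)
          * (c * d * (q * Q) - a * q)
    identity = solve-∀ ℚ-ring

  1⊘qⁿ≡q⁻¹ⁿ : ∀ n → 1ℚ ⊘ q ^ n ≡ q⁻¹ ^ n
  1⊘qⁿ≡q⁻¹ⁿ n = *-cancelˡ-≡ qⁿ≢0
    (trans (*-comm (q ^ n) (1ℚ ⊘ q ^ n)) (trans ([p⊘r]*r≡p 1ℚ qⁿ≢0) (sym (x*y≡1⇒xⁿ*yⁿ≡1 n q*q⁻¹≡1))))
    where
    qⁿ≢0 = x≢0⇒xⁿ≢0 n q≢0

  clearing-factor-split : ∀ {n k} a b c → k ≤ n → a * b ≡ c →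
    poch (a * q) q n * hpoch a c q n
      ≡ poch (a * q) q k * poch b q k * (poch (a * q ^ suc k) q (n ∸ k) * a ^ k * hpoch a (c * q ^ k) q (n ∸ k))
  clearing-factor-split {n} {k} a b c k≤n ab≡c = begin
    poch (a * q) q n * hpoch a c q n
      ≡⟨ cong (λ i → poch (a * q) q i * hpoch a c q i) (ℕ.m+[n∸m]≡n k≤n) ⟨
    poch (a * q) q (k + t) * hpoch a c q (k + t)
      ≡⟨ cong₂ _*_ (poch-+ (a * q) q k t) (hpoch-+ a c q k t) ⟩
    poch (a * q) q k * poch (a * q * q ^ k) q t * (hpoch a c q k * H)
      ≡⟨ cong₂ (λ x h → poch (a * q) q k * poch x q t * (h * H)) (sym (*-assoc a q (q ^ k))) (^*poch≡hpoch q k ab≡c) ⟨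
    poch (a * q) q k * poch (a * q ^ suc k) q t * (a ^ k * poch b q k * H)
      ≡⟨ regroup (poch (a * q) q k) (poch (a * q ^ suc k) q t) (a ^ k) (poch b q k) H ⟩
    poch (a * q) q k * poch b q k * (poch (a * q ^ suc k) q t * a ^ k * H) ∎
    where
    t = n ∸ k
    H = hpoch a (c * q ^ k) q t
    regroup : ∀ A P α B H → A * P * (α * B * H) ≡ A * B * (P * α * H)
    regroup = solve-∀ ℚ-ring

  summand-cleared : ∀ {n k} a b c → k ≤ n → a * b ≡ c →
    poch q q n ≢ 0ℚ → poch (a * q) q n ≢ 0ℚ → poch b q n ≢ 0ℚ →
    summand q n a b c k * (poch (a * q) q n * hpoch a c q n) ≡ weight n k * term a c k (n ∸ k)
  summand-cleared {n} {k} a b c k≤n ab≡c qₙ≢0 aqₙ≢0 bₙ≢0 = *-cancelˡ-≡ Qₖ≢0 (begin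
    Qₖ * (N ⊘ D * q ^ k * (poch (a * q) q n * hpoch a c q n))
      ≡⟨ cong (λ x → Qₖ * (N ⊘ D * q ^ k * x)) (clearing-factor-split a b c k≤n ab≡c) ⟩
    Qₖ * (N ⊘ D * q ^ k * (Aₖ * Bₖ * (P * α * H)))
      ≡⟨ regroup₁ Qₖ Aₖ Bₖ (N ⊘ D) (q ^ k) (P * α * H) ⟩
    N ⊘ D * D * (q ^ k * (P * α * H))
      ≡⟨ cong (_* (q ^ k * (P * α * H))) ([p⊘r]*r≡p N D≢0) ⟩
    poch (1ℚ ⊘ q ^ n) q k * C * (q ^ k * (P * α * H))
      ≡⟨ regroup₂ (poch (1ℚ ⊘ q ^ n) q k) C (q ^ k) P α H ⟩
    poch (1ℚ ⊘ q ^ n) q k * q ^ k * term a c k t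
      ≡⟨ cong (λ x → poch x q k * q ^ k * term a c k t) (1⊘qⁿ≡q⁻¹ⁿ n) ⟩
    poch (q⁻¹ ^ n) q k * q ^ k * term a c k t
      ≡⟨ cong (_* term a c k t) (weight-poch n k) ⟨
    weight n k * Qₖ * term a c k t
      ≡⟨ regroup₃ (weight n k) Qₖ (term a c k t) ⟩
    Qₖ * (weight n k * term a c k t) ∎)
    where
    t = n ∸ k
    Qₖ = poch q q k
    Aₖ = poch (a * q) q k
    Bₖ = poch b q k
    C = poch c q (k + k)
    P = poch (a * q ^ suc k) q t
    α = a ^ k
    H = hpoch a (c * q ^ k) q t
    N = poch (1ℚ ⊘ q ^ n) q k * C
    D = Qₖ * Aₖ * Bₖ
    Qₖ≢0 = poch≢0-≤ k≤n qₙ≢0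
    D≢0 = x*y≢0 (x*y≢0 Qₖ≢0 (poch≢0-≤ k≤n aqₙ≢0)) (poch≢0-≤ k≤n bₙ≢0)
    regroup₁ : ∀ Q A B z u R → Q * (z * u * (A * B * R)) ≡ z * (Q * A * B) * (u * R)
    regroup₁ = solve-∀ ℚ-ring
    regroup₂ : ∀ p C u P α H → p * C * (u * (P * α * H)) ≡ p * u * (C * P * α * H)
    regroup₂ = solve-∀ ℚ-ring
    regroup₃ : ∀ w Q X → w * Q * X ≡ Q * (w * X)
    regroup₃ = solve-∀ ℚ-ring

  sumTo-summand-cleared : ∀ n a b c → a * b ≡ c →
    poch q q n ≢ 0ℚ → poch (a * q) q n ≢ 0ℚ → poch b q n ≢ 0ℚ →
    sumTo n (summand q n a b c) * (poch (a * q) q n * hpoch a c q n) ≡ Φ n a c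
  sumTo-summand-cleared n a b c ab≡c qₙ≢0 aqₙ≢0 bₙ≢0 =
    trans (*-distribʳ-sumTo n (poch (a * q) q n * hpoch a c q n) (summand q n a b c))
          (sumTo-cong-≤ n (λ k≤n → summand-cleared a b c k≤n ab≡c qₙ≢0 aqₙ≢0 bₙ≢0))

  Φ-identity : ∀ n a c d e → c ≢ 0ℚ → a * e ≡ d → e * c * q ^ n ≡ q →
    hpoch a d q n * (poch d q n * Φ n a c) ≡ hpoch a c q n * (poch c q n * Φ n a d)
  Φ-identity n a c d e c≢0 ae≡d ecqⁿ≡q = *-cancelˡ-≡ K≢0 (begin
    K * (hpoch a d q n * (Dₙ * Φ n a c))
      ≡⟨ cong (λ h → K * (h * (Dₙ * Φ n a c))) (^*poch≡hpoch q n ae≡d) ⟨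
    K * (a ^ n * Eₙ * (Dₙ * Φ n a c))
      ≡⟨ regroup₁ (c ^ n) T (a ^ n) Eₙ Dₙ (Φ n a c) ⟩
    a ^ n * (c ^ n * Eₙ * T) * (c ^ n * Dₙ * T) * Φ n a c
      ≡⟨ cong₂ (λ x y → a ^ n * x * y * Φ n a c) reverse-e reverse-d ⟩
    a ^ n * (s * Cₙ) * (s * hpoch a c q n) * Φ n a c
      ≡⟨ regroup₂ (a ^ n) s Cₙ (hpoch a c q n) (Φ n a c) ⟩
    s * s * (hpoch a c q n * (Cₙ * (a ^ n * Φ n a c)))
      ≡⟨ cong₂ (λ u v → u * (hpoch a c q n * (Cₙ * v))) (sym s*s≡1) (Φ-symmetry n a c d cdqⁿ≡aq) ⟨
    1ℚ * (hpoch a c q n * (Cₙ * (K * Φ n a d)))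
      ≡⟨ regroup₃ K (hpoch a c q n) Cₙ (Φ n a d) ⟩
    K * (hpoch a c q n * (Cₙ * Φ n a d)) ∎)
    where
    T = q ^choose₂ n
    K = c ^ n * c ^ n * (T * T)
    s = (- 1ℚ) ^ n
    s*s≡1 : s * s ≡ 1ℚ
    s*s≡1 = x*y≡1⇒xⁿ*yⁿ≡1 n refl
    Cₙ = poch c q n
    Dₙ = poch d q n
    Eₙ = poch e q n
    K≢0 = x*y≢0 (x*y≢0 (x≢0⇒xⁿ≢0 n c≢0) (x≢0⇒xⁿ≢0 n c≢0)) (x*y≢0 (q≢0⇒q^choose₂n≢0 n q≢0) (q≢0⇒q^choose₂n≢0 n q≢0))
    dcqⁿ≡aq : d * c * q ^ n ≡ a * q
    dcqⁿ≡aq = begin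
      d * c * q ^ n        ≡⟨ cong (λ x → x * c * q ^ n) ae≡d ⟨
      a * e * c * q ^ n    ≡⟨ trans (cong (_* q ^ n) (*-assoc a e c)) (*-assoc a (e * c) (q ^ n)) ⟩
      a * (e * c * q ^ n)  ≡⟨ cong (a *_) ecqⁿ≡q ⟩
      a * q                ∎
    cdqⁿ≡aq : c * d * q ^ n ≡ a * q
    cdqⁿ≡aq = trans (cong (_* q ^ n) (*-comm c d)) dcqⁿ≡aq
    reverse-e : c ^ n * Eₙ * T ≡ s * Cₙ
    reverse-e = trans (poch-reverse n e c 1ℚ q≢0 (trans ecqⁿ≡q (sym (*-identityˡ q)))) (cong (s *_) (hpoch-1 c q n))
    reverse-d : c ^ n * Dₙ * T ≡ s * hpoch a c q n
    reverse-d = poch-reverse n d c a q≢0 dcqⁿ≡aq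
    regroup₁ : ∀ γ T α E D F → γ * γ * (T * T) * (α * E * (D * F)) ≡ α * (γ * E * T) * (γ * D * T) * F
    regroup₁ = solve-∀ ℚ-ring
    regroup₂ : ∀ α s C h F → α * (s * C) * (s * h) * F ≡ s * s * (h * (C * (α * F)))
    regroup₂ = solve-∀ ℚ-ring
    regroup₃ : ∀ K h C F → 1ℚ * (h * (C * (K * F))) ≡ K * (h * (C * F))
    regroup₃ = solve-∀ ℚ-ring

lemma5p1 : (n : ℕ) (a c q : ℚ) →
    a ≢ 0ℚ → c ≢ 0ℚ → q ≢ 0ℚ →
    poch q q n ≢ 0ℚ →
    poch (a * q) q n ≢ 0ℚ →
    poch (c ⊘ a) q n ≢ 0ℚ →
    poch ((a * (q ⊘ q ^ n)) ⊘ c) q n ≢ 0ℚ →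
    poch ((q ⊘ q ^ n) ⊘ c) q n ≢ 0ℚ →
    sumTo n (λ k →
        ((poch (1ℚ ⊘ q ^ n) q k * poch c q (k + k))
          ⊘ (poch q q k * poch (a * q) q k * poch (c ⊘ a) q k))
        * q ^ k)
    ≡
    (poch c q n ⊘ poch ((a * (q ⊘ q ^ n)) ⊘ c) q n)
    * sumTo n (λ k →
        ((poch (1ℚ ⊘ q ^ n) q k * poch ((a * (q ⊘ q ^ n)) ⊘ c) q (k + k))
          ⊘ (poch q q k * poch (a * q) q k * poch ((q ⊘ q ^ n) ⊘ c) q k))
        * q ^ k)
lemma5p1 n a c q a≢0 c≢0 q≢0 qₙ≢0 aqₙ≢0 [c⊘a]ₙ≢0 dₙ≢0 eₙ≢0 =
  cross-multiply {r = sumTo n (summand q n a e d)} {z = poch c q n ⊘ poch d q n}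
    (x*y≢0 aqₙ≢0 (hpoch≢0 q n a≢0 [c⊘a]ₙ≢0 a[c⊘a]≡c))
    (x*y≢0 aqₙ≢0 (hpoch≢0 q n a≢0 eₙ≢0 ae≡d))
    dₙ≢0
    (sumTo-summand-cleared n a (c ⊘ a) c a[c⊘a]≡c qₙ≢0 aqₙ≢0 [c⊘a]ₙ≢0)
    (sumTo-summand-cleared n a e d ae≡d qₙ≢0 aqₙ≢0 eₙ≢0)
    ([p⊘r]*r≡p (poch c q n) dₙ≢0)
    (trans (*-assoc (poch (a * q) q n) _ _)
      (trans (cong (poch (a * q) q n *_) (Φ-identity n a c d e c≢0 ae≡d ecqⁿ≡q)) (sym (*-assoc (poch (a * q) q n) _ _))))
  where
  open Cleared q (1ℚ ⊘ q) (trans (*-comm q (1ℚ ⊘ q)) ([p⊘r]*r≡p 1ℚ q≢0)) using (sumTo-summand-cleared; Φ-identity)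
  d = (a * (q ⊘ q ^ n)) ⊘ c
  e = (q ⊘ q ^ n) ⊘ c
  a[c⊘a]≡c : a * (c ⊘ a) ≡ c
  a[c⊘a]≡c = trans (*-comm a (c ⊘ a)) ([p⊘r]*r≡p c a≢0)
  ecqⁿ≡q : e * c * q ^ n ≡ q
  ecqⁿ≡q = trans (cong (_* q ^ n) ([p⊘r]*r≡p (q ⊘ q ^ n) c≢0)) ([p⊘r]*r≡p q (x≢0⇒xⁿ≢0 n q≢0))
  ae≡d : a * e ≡ d
  ae≡d = *-cancelˡ-≡ c≢0 (begin
    c * (a * e)      ≡⟨ trans (*-comm c (a * e)) (*-assoc a e c) ⟩
    a * (e * c)      ≡⟨ cong (a *_) ([p⊘r]*r≡p (q ⊘ q ^ n) c≢0) ⟩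
    a * (q ⊘ q ^ n)  ≡⟨ [p⊘r]*r≡p (a * (q ⊘ q ^ n)) c≢0 ⟨
    d * c            ≡⟨ *-comm d c ⟩
    c * d            ∎)
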